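{- For every unsatisfiable hitting clause-set $F$, $\mathrm{singind}(F)\le 2\,\mathrm{nosv}(F)+\mathrm{nnosv}(F)$.
   Context: Variables are positive integers, literals are nonzero integers, the complement of $x$ is $\overline{x}=-x$. A clause is a finite set of literals with no pair $x,\overline{x}$; a clause-set is a finite set of clauses. $F$ is satisfiable if some clause meets every clause of $F$, otherwise unsatisfiable. $F$ is hitting if any two distinct clauses $C,D\in F$ have some $x\in C$ with $\overline{x}\in D$. $\mathrm{ldeg}_F(x)$ is the number of clauses containing $x$; a variable $v$ of $F$ is singular if $\min(\mathrm{ldeg}_F(v),\mathrm{ldeg}_F(\overline v))=1$, and $1$-singular if moreover $\mathrm{ldeg}_F(v)+\mathrm{ldeg}_F(\overline v)=2$. $\mathrm{nosv}(F)$ is the number of $1$-singular variables of $F$, and $\mathrm{nnosv}(F)$ the number of singular variables of $F$ that are not $1$-singular. For a singular variable $v$, singular DP-reduction replaces $F$ by $\mathrm{DP}_v(F):=\{(A\cup B)\setminus\{v,\overline v\}: A,B\in F, A\cap\overline{B}=\{v\}\}\cup\{A\in F: v \text{ does not occur in } A\}$. For an unsatisfiable hitting clause-set $F$, every maximal sequence of singular DP-reductions has the same length, denoted $\mathrm{singind}(F)$. -}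

module Defs where

open import Data.Nat as ℕ using (ℕ; zero; suc; _⊓_)
open import Data.Integer as ℤ using (ℤ; +_; -_; ∣_∣)
open import Data.List using (List; []; _∷_; length; filter; deduplicate; concat; map)
open import Data.List.Membership.Propositional using (_∈_; _∉_)
open import Data.List.Membership.DecPropositional ℤ._≟_ using (_∈?_)
open import Data.List.Relation.Unary.All using (All)
open import Data.List.Relation.Unary.Linked using (Linked)
open import Data.List.Relation.Unary.Unique.Propositional using (Unique)
open import Data.Product using (Σ; ∃; _×_; _,_)
open import Data.Sum using (_⊎_)
open import Relation.Nullary using (¬_; Dec; ¬?)
open import Relation.Nullary.Decidable using (_×-dec_)
open import Relation.Binary.PropositionalEquality using (_≡_; _≢_)
open import Function.Bundles using (_⇔_)

-- Literals are nonzero integers, variables positive integers, complement is negation.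
Literal = ℤ
Clause = List ℤ
ClauseSet = List Clause

IsClause : List ℤ → Set
IsClause C = All (λ x → x ≢ + 0) C × (∀ x → x ∈ C → - x ∉ C)

-- Canonical representation of a clause: strictly increasing list, so that
-- equality of clauses as sets is equality of lists.
CanonicalClause : Clause → Set
CanonicalClause C = IsClause C × Linked ℤ._<_ C

IsClauseSet : ClauseSet → Set
IsClauseSet F = All CanonicalClause F × Unique F

Satisfiable : ClauseSet → Set
Satisfiable F = ∃ λ (T : List ℤ) → IsClause T × All (λ C → ∃ λ x → x ∈ T × x ∈ C) F

Unsatisfiable : ClauseSet → Set
Unsatisfiable F = ¬ Satisfiable F

Hitting : ClauseSet → Set
Hitting F = ∀ C D → C ∈ F → D ∈ F → C ≢ D → ∃ λ x → x ∈ C × - x ∈ D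

ldeg : ClauseSet → Literal → ℕ
ldeg F x = length (filter (λ C → x ∈? C) F)

Singular : ClauseSet → ℤ → Set
Singular F v = (+ 0 ℤ.< v) × ((ldeg F v ⊓ ldeg F (- v)) ≡ 1)

OneSingular : ClauseSet → ℤ → Set
OneSingular F v = Singular F v × (ldeg F v ℕ.+ ldeg F (- v) ≡ 2)

Singular? : ∀ F v → Dec (Singular F v)
Singular? F v = (+ 0 ℤ.<? v) ×-dec ((ldeg F v ⊓ ldeg F (- v)) ℕ.≟ 1)

OneSingular? : ∀ F v → Dec (OneSingular F v)
OneSingular? F v = Singular? F v ×-dec ((ldeg F v ℕ.+ ldeg F (- v)) ℕ.≟ 2)

NonOneSingular? : ∀ F v → Dec (Singular F v × ¬ OneSingular F v)
NonOneSingular? F v = Singular? F v ×-dec ¬? (OneSingular? F v)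

vars : ClauseSet → List ℤ
vars F = deduplicate ℤ._≟_ (map (λ x → + ∣ x ∣) (concat F))

nosv : ClauseSet → ℕ
nosv F = length (filter (OneSingular? F) (vars F))

nnosv : ClauseSet → ℕ
nnosv F = length (filter (NonOneSingular? F) (vars F))

IsResolvent : ClauseSet → ℤ → Clause → Set
IsResolvent F v C =
  ∃ λ A → ∃ λ B → A ∈ F × B ∈ F × v ∈ A × - v ∈ B
    × (∀ x → x ∈ A → - x ∈ B → x ≡ v)
    × (∀ x → x ∈ C ⇔ ((x ∈ A ⊎ x ∈ B) × x ≢ v × x ≢ - v))

IsDP : ClauseSet → ℤ → ClauseSet → Set
IsDP F v G = IsClauseSet G ×
  (∀ C → C ∈ G ⇔ (IsResolvent F v C ⊎ (C ∈ F × v ∉ C × - v ∉ C)))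

SDPStep : ClauseSet → ClauseSet → Set
SDPStep F G = ∃ λ v → Singular F v × IsDP F v G

data SDPSeq : ClauseSet → ClauseSet → ℕ → Set where
  done : ∀ {F} → SDPSeq F F 0
  step : ∀ {F G H n} → SDPStep F G → SDPSeq G H n → SDPSeq F H (suc n)

NoSingular : ClauseSet → Set
NoSingular G = ∀ v → ¬ Singular G v

{-# OPTIONS --safe #-}
-- Weigh each variable 2 if it is 1-singular, 1 if it is singular but not 1-singular, and 0
-- otherwise; the total weight is 2 · nosv + nnosv, and we show that it drops with every singular
-- DP-reduction.  If the literal s occurs only in the clause A, unsatisfiability and hitting give
-- A \ {s} ⊆ B for every clause B ∋ -s, so DP_s replaces each such B by B \ {-s} and keeps the
-- clause-set unsatisfiable and hitting.  The variable of s loses its weight (at least 1).  Apart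
-- from ±s, only the literals of A \ {s} lose an occurrence, which raises a weight by at most 1,
-- and only if -s occurred once, i.e. if var s had weight 2; even then at most one variable gains,
-- because two singular literals of an unsatisfiable hitting clause-set never share a clause.
module Submission where

open import Data.Empty using (⊥-elim)
open import Data.Integer as ℤ using (ℤ; +_; -_; ∣_∣)
open import Data.Integer.Properties as ℤ using (neg-involutive; neg-injective)
open import Data.List using (List; []; _∷_; length; filter; map; concat)
open import Data.List.Membership.Propositional using (_∈_; _∉_)
open import Data.List.Membership.Propositional.Properties
  using (∈-filter⁺; ∈-filter⁻; ∈-map⁺; ∈-map⁻; ∈-length; ∈-concat⁺′; ∈-concat⁻′; ∈-deduplicate⁺; ∈-deduplicate⁻)
open import Data.List.Membership.Propositional.Properties.WithK using (unique∧set⇒bag)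
open import Data.List.Membership.DecPropositional ℤ._≟_ using (_∈?_)
open import Data.List.Properties using (≡-dec; filter-all; filter-accept; filter-reject; filter-≐)
open import Data.List.Relation.Binary.BagAndSetEquality using (_∼[_]_; set; ∼bag⇒↭)
open import Data.List.Relation.Binary.Permutation.Propositional.Properties using (↭-length; filter-↭)
open import Data.List.Relation.Binary.Subset.Propositional using (_⊆_)
open import Data.List.Relation.Binary.Subset.Propositional.Properties using (filter-⊆)
open import Data.List.Relation.Unary.All as All using (All; []; _∷_)
import Data.List.Relation.Unary.All.Properties as All
open import Data.List.Relation.Unary.AllPairs using (AllPairs; []; _∷_)
open import Data.List.Relation.Unary.Any using (here; there)
import Data.List.Relation.Unary.Linked.Properties as Linked
open import Data.List.Relation.Unary.Unique.Propositional using (Unique)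
import Data.List.Relation.Unary.Unique.Propositional.Properties as Unique
open import Data.List.Relation.Unary.Unique.DecPropositional.Properties ℤ._≟_ using (deduplicate-!)
open import Data.Nat as ℕ using (ℕ; zero; suc; _≤_; _<_; _+_; _*_; _∸_; _⊓_; z≤n; s≤s)
open import Data.Nat.ListAction using (sum)
import Data.Nat.Properties as ℕ
open import Algebra.Properties.CommutativeSemigroup ℕ.+-commutativeSemigroup using (interchange)
open import Data.Product using (∃; _×_; _,_; proj₁; proj₂)
open import Data.Sum as Sum using (_⊎_; inj₁; inj₂; [_,_]′)
open import Function using (_∘_)
open import Function.Bundles using (_⇔_; mk⇔; Equivalence)
open import Relation.Binary.PropositionalEquality
  using (_≡_; _≢_; refl; sym; trans; cong; cong₂; subst; module ≡-Reasoning)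
open import Relation.Nullary using (¬_; yes; no; ¬?; contradiction)
open import Relation.Unary using (Pred; Decidable; _≐_)

open import Defs

open Equivalence using (to; from)

count : ∀ {a p} {A : Set a} {P : Pred A p} → Decidable P → List A → ℕ
count P? xs = length (filter P? xs)

module _ {a} {A : Set a} where

  length≥2 : ∀ {x y : A} {xs} → x ∈ xs → y ∈ xs → x ≢ y → 2 ≤ length xs
  length≥2 (here refl) (here refl) x≢y = contradiction refl x≢y
  length≥2 (here _) (there y∈) _ = s≤s (∈-length y∈)
  length≥2 (there x∈) (here _) _ = s≤s (∈-length x∈)
  length≥2 (there x∈) (there y∈) x≢y = ℕ.m≤n⇒m≤1+n (length≥2 x∈ y∈ x≢y)

  unique-map⁺ : ∀ {b} {B : Set b} {f : A → B} {xs} →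
                (∀ {x y} → x ∈ xs → y ∈ xs → f x ≡ f y → x ≡ y) → Unique xs → Unique (map f xs)
  unique-map⁺ {xs = []} _ [] = []
  unique-map⁺ {xs = x ∷ xs} injective (x∉ ∷ !xs) =
    All.map⁺ (All.tabulate λ y∈ fx≡fy → All.lookup x∉ y∈ (injective (here refl) (there y∈) fx≡fy))
    ∷ unique-map⁺ (λ x∈ y∈ → injective (there x∈) (there y∈)) !xs

module _ {a p} {A : Set a} {P : Pred A p} (P? : Decidable P) where

  count-∼set : ∀ {xs ys} → Unique xs → Unique ys → xs ∼[ set ] ys → count P? xs ≡ count P? ys
  count-∼set !xs !ys xs≈ys = ↭-length (filter-↭ P? (∼bag⇒↭ (unique∧set⇒bag !xs !ys xs≈ys)))

  count-map : ∀ {b} {B : Set b} (f : B → A) xs → count P? (map f xs) ≡ count (P? ∘ f) xs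
  count-map f [] = refl
  count-map f (x ∷ xs) with P? (f x)
  ... | yes _ = cong suc (count-map f xs)
  ... | no _ = count-map f xs

  count-mono : ∀ {q} {Q : Pred A q} (Q? : Decidable Q) {xs} →
               (∀ {x} → x ∈ xs → P x → Q x) → count P? xs ≤ count Q? xs
  count-mono Q? {[]} _ = z≤n
  count-mono Q? {x ∷ xs} P⇒Q with P? x | Q? x
  ... | yes _ | yes _ = s≤s (count-mono Q? (P⇒Q ∘ there))
  ... | yes px | no ¬qx = contradiction (P⇒Q (here refl) px) ¬qx
  ... | no _ | yes _ = ℕ.m≤n⇒m≤1+n (count-mono Q? (P⇒Q ∘ there))
  ... | no _ | no _ = count-mono Q? (P⇒Q ∘ there)

  count>0⇒∃ : ∀ {xs} → 0 < count P? xs → ∃ λ x → x ∈ xs × P x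
  count>0⇒∃ {x ∷ xs} pos with P? x
  ... | yes px = x , here refl , px
  ... | no _ = let y , y∈ , py = count>0⇒∃ pos in y , there y∈ , py

  count≡1⇒∃! : ∀ {xs} → count P? xs ≡ 1 →
                ∃ λ x → x ∈ xs × P x × (∀ {y} → y ∈ xs → P y → y ≡ x)
  count≡1⇒∃! {xs} one with filter P? xs in eq
  count≡1⇒∃! {xs} refl | x ∷ [] = x , proj₁ x∈ , proj₂ x∈ , only-x
    where
    x∈ : x ∈ xs × P x
    x∈ = ∈-filter⁻ P? (subst (x ∈_) (sym eq) (here refl))
    only-x : ∀ {y} → y ∈ xs → P y → y ≡ x
    only-x y∈ py with subst (_ ∈_) eq (∈-filter⁺ P? y∈ py)
    ... | here y≡x = y≡x

  count≥2 : ∀ {xs x y} → x ∈ xs → y ∈ xs → x ≢ y → P x → P y → 2 ≤ count P? xs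
  count≥2 x∈ y∈ x≢y px py = length≥2 (∈-filter⁺ P? x∈ px) (∈-filter⁺ P? y∈ py) x≢y

module _ {a} {A : Set a} where

  sum-map>0⇒∃ : ∀ (f : A → ℕ) {xs} → 0 < sum (map f xs) → ∃ λ x → x ∈ xs × 0 < f x
  sum-map>0⇒∃ f {x ∷ xs} pos with f x in fx
  ... | suc _ = x , here refl , subst (0 <_) (sym fx) (s≤s z≤n)
  ... | zero = let y , y∈ , fy>0 = sum-map>0⇒∃ f pos in y , there y∈ , fy>0

  sum-map-≤1 : ∀ (f : A → ℕ) {xs} → Unique xs → (∀ {x} → x ∈ xs → f x ≤ 1) →
               (∀ {x y} → x ∈ xs → y ∈ xs → 0 < f x → 0 < f y → x ≡ y) → sum (map f xs) ≤ 1
  sum-map-≤1 f {[]} _ _ _ = z≤n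
  sum-map-≤1 f {x ∷ xs} (x∉ ∷ !xs) ≤1 at-most-one with 0 ℕ.<? sum (map f xs)
  ... | no ¬pos = ℕ.+-mono-≤ (≤1 (here refl)) (ℕ.≮⇒≥ ¬pos)
  ... | yes pos = ℕ.≤-trans (ℕ.≤-reflexive (cong (_+ sum (map f xs)) fx≡0))
                    (sum-map-≤1 f !xs (≤1 ∘ there) (λ x∈ y∈ → at-most-one (there x∈) (there y∈)))
    where
    fx≡0 : f x ≡ 0
    fx≡0 = ℕ.n≤0⇒n≡0 (ℕ.≮⇒≥ λ fx>0 →
      let y , y∈ , fy>0 = sum-map>0⇒∃ f pos
      in All.lookup x∉ y∈ (at-most-one (here refl) (there y∈) fx>0 fy>0))

  module _ (f g : A → ℕ) where

    sum-map-≤-+∸ : ∀ xs → sum (map g xs) ≤ sum (map f xs) + sum (map (λ x → g x ∸ f x) xs)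
    sum-map-≤-+∸ [] = z≤n
    sum-map-≤-+∸ (x ∷ xs) = ℕ.≤-trans
      (ℕ.+-mono-≤ (ℕ.m≤n+m∸n (g x) (f x)) (sum-map-≤-+∸ xs))
      (ℕ.≤-reflexive (interchange (f x) (g x ∸ f x) _ _))

    sum-map-< : ∀ {v xs} → v ∈ xs → g v ≡ 0 →
      sum (map (λ x → g x ∸ f x) xs) < f v → sum (map g xs) < sum (map f xs)
    sum-map-< {v} {xs} v∈ gv≡0 gains<fv = ℕ.+-cancelʳ-< (f v) _ _ (begin-strict
        sum (map g xs) + f v      ≤⟨ ≤-freeing v∈ ⟩
        sum (map f xs) + gains    <⟨ ℕ.+-monoʳ-< (sum (map f xs)) gains<fv ⟩
        sum (map f xs) + f v      ∎)
      where
      open ℕ.≤-Reasoning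
      gains = sum (map (λ x → g x ∸ f x) xs)
      ≤-freeing : ∀ {ys} → v ∈ ys →
        sum (map g ys) + f v ≤ sum (map f ys) + sum (map (λ x → g x ∸ f x) ys)
      ≤-freeing {x ∷ ys} (here refl) = begin
        g v + sum (map g ys) + f v        ≡⟨ cong (λ t → t + sum (map g ys) + f v) gv≡0 ⟩
        sum (map g ys) + f v              ≡⟨ ℕ.+-comm (sum (map g ys)) (f v) ⟩
        f v + sum (map g ys)              ≤⟨ ℕ.+-mono-≤ (ℕ.m≤m+n (f v) (g v ∸ f v)) (sum-map-≤-+∸ ys) ⟩
        f v + (g v ∸ f v) + (sum (map f ys) + sum (map (λ x → g x ∸ f x) ys))
                                          ≡⟨ interchange (f v) (g v ∸ f v) _ _ ⟩
        f v + sum (map f ys) + (g v ∸ f v + sum (map (λ x → g x ∸ f x) ys)) ∎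
      ≤-freeing {x ∷ ys} (there v∈ys) = begin
        g x + sum (map g ys) + f v        ≡⟨ ℕ.+-assoc (g x) _ (f v) ⟩
        g x + (sum (map g ys) + f v)      ≤⟨ ℕ.+-mono-≤ (ℕ.m≤n+m∸n (g x) (f x)) (≤-freeing v∈ys) ⟩
        f x + (g x ∸ f x) + (sum (map f ys) + sum (map (λ x → g x ∸ f x) ys))
                                          ≡⟨ interchange (f x) (g x ∸ f x) _ _ ⟩
        f x + sum (map f ys) + (g x ∸ f x + sum (map (λ x → g x ∸ f x) ys)) ∎

  module _ {p} {O N : Pred A p} (O? : Decidable O) (N? : Decidable N) (f : A → ℕ) where

    sum-map≡2*count+count : ∀ xs →
      (∀ {x} → x ∈ xs → O x → f x ≡ 2) → (∀ {x} → x ∈ xs → N x → f x ≡ 1) →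
      (∀ {x} → x ∈ xs → ¬ O x → ¬ N x → f x ≡ 0) →
      sum (map f xs) ≡ 2 * count O? xs + count N? xs
    sum-map≡2*count+count [] _ _ _ = refl
    sum-map≡2*count+count (x ∷ xs) f≡2 f≡1 f≡0
      with O? x | N? x | sum-map≡2*count+count xs (f≡2 ∘ there) (f≡1 ∘ there) (f≡0 ∘ there)
    ... | yes o | yes n | _ = contradiction (trans (sym (f≡2 (here refl) o)) (f≡1 (here refl) n)) λ ()
    ... | yes o | no _ | ih = begin
      f x + sum (map f xs)                   ≡⟨ cong₂ _+_ (f≡2 (here refl) o) ih ⟩
      2 + (2 * count O? xs + count N? xs)    ≡⟨ ℕ.+-assoc 2 (2 * count O? xs) (count N? xs) ⟨
      2 + 2 * count O? xs + count N? xs      ≡⟨ cong (_+ count N? xs) (ℕ.*-suc 2 (count O? xs)) ⟨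
      2 * suc (count O? xs) + count N? xs    ∎
      where open ≡-Reasoning
    ... | no _ | yes n | ih =
      trans (cong₂ _+_ (f≡1 (here refl) n) ih) (sym (ℕ.+-suc (2 * count O? xs) (count N? xs)))
    ... | no ¬o | no ¬n | ih = cong₂ _+_ (f≡0 (here refl) ¬o ¬n) ih

var : Literal → ℤ
var x = + ∣ x ∣

var-neg : ∀ x → var (- x) ≡ var x
var-neg x = cong +_ (ℤ.∣-i∣≡∣i∣ x)

var-pos : ∀ {w} → + 0 ℤ.< w → var w ≡ w
var-pos w>0 = ℤ.0≤i⇒+∣i∣≡i (ℤ.<⇒≤ w>0)

var>0 : ∀ {x} → x ≢ + 0 → + 0 ℤ.< var x
var>0 {+ zero} x≢0 = contradiction refl x≢0
var>0 {+ suc _} _ = ℤ.+<+ (s≤s z≤n)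
var>0 {ℤ.-[1+ _ ]} _ = ℤ.+<+ (s≤s z≤n)

-x≡x⇒x≡0 : ∀ {x} → - x ≡ x → x ≡ + 0
-x≡x⇒x≡0 {+ zero} _ = refl

neg-≢ : ∀ {x y} → - x ≢ y → x ≢ - y
neg-≢ {y = y} -x≢y x≡-y = -x≢y (trans (cong -_ x≡-y) (neg-involutive y))

∈-map-neg⁺ : ∀ {x C} → - x ∈ C → x ∈ map -_ C
∈-map-neg⁺ {x} -x∈C = subst (_∈ map -_ _) (neg-involutive x) (∈-map⁺ -_ -x∈C)

∈-map-neg⁻ : ∀ {x C} → - x ∈ map -_ C → x ∈ C
∈-map-neg⁻ -x∈ with ∈-map⁻ -_ -x∈
... | y , y∈C , -x≡-y = subst (_∈ _) (sym (neg-injective -x≡-y)) y∈C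

remove : Literal → Clause → Clause
remove x = filter (λ y → ¬? (y ℤ.≟ x))

∈-remove⁺ : ∀ {x y C} → y ∈ C → y ≢ x → y ∈ remove x C
∈-remove⁺ {x} = ∈-filter⁺ (λ y → ¬? (y ℤ.≟ x))

∈-remove⁻ : ∀ {x y} C → y ∈ remove x C → y ∈ C × y ≢ x
∈-remove⁻ {x} C = ∈-filter⁻ (λ y → ¬? (y ℤ.≟ x)) {xs = C}

remove-∉ : ∀ {x C} → x ∉ C → remove x C ≡ C
remove-∉ {x} x∉C =
  filter-all (λ y → ¬? (y ℤ.≟ x)) (All.tabulate λ y∈C y≡x → x∉C (subst (_∈ _) y≡x y∈C))

IsClause-⊆ : ∀ {C D} → C ⊆ D → IsClause D → IsClause C
IsClause-⊆ C⊆D (nonzero , consistent) =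
  All.tabulate (All.lookup nonzero ∘ C⊆D) , λ x x∈C -x∈C → consistent x (C⊆D x∈C) (C⊆D -x∈C)

IsClause-∷ : ∀ {x C} → x ≢ + 0 → - x ∉ C → IsClause C → IsClause (x ∷ C)
IsClause-∷ {x} {C} x≢0 -x∉C (nonzero , consistent) = x≢0 ∷ nonzero , consistent′
  where
  consistent′ : ∀ y → y ∈ x ∷ C → - y ∉ x ∷ C
  consistent′ y (here refl) (here -x≡x) = x≢0 (-x≡x⇒x≡0 -x≡x)
  consistent′ y (here refl) (there -x∈C) = -x∉C -x∈C
  consistent′ y (there y∈C) (here -y≡x) =
    -x∉C (subst (_∈ C) (trans (sym (neg-involutive y)) (cong -_ -y≡x)) y∈C)
  consistent′ y (there y∈C) (there -y∈C) = consistent y y∈C -y∈C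

IsClause-neg : ∀ {C} → IsClause C → IsClause (map -_ C)
IsClause-neg {C} (nonzero , consistent) =
  All.map⁺ (All.map (λ x≢0 -x≡0 → x≢0 (neg-injective {j = + 0} -x≡0)) nonzero) , consistent′
  where
  consistent′ : ∀ y → y ∈ map -_ C → - y ∉ map -_ C
  consistent′ y y∈ -y∈ with ∈-map⁻ -_ y∈
  ... | x , x∈C , refl = consistent x x∈C (∈-map-neg⁻ -y∈)

sorted-ext : ∀ {xs ys : List ℤ} → AllPairs ℤ._<_ xs → AllPairs ℤ._<_ ys → xs ∼[ set ] ys → xs ≡ ys
sorted-ext {[]} {[]} _ _ _ = refl
sorted-ext {[]} {y ∷ _} _ _ xs≈ys with from xs≈ys (here refl)
... | ()
sorted-ext {x ∷ _} {[]} _ _ xs≈ys with to xs≈ys (here refl)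
... | ()
sorted-ext {x ∷ xs} {y ∷ ys} (x< ∷ <xs) (y< ∷ <ys) xys≈ = cong₂ _∷_ x≡y (sorted-ext <xs <ys xs≈ys)
  where
  x≡y : x ≡ y
  x≡y with to xys≈ (here refl) | from xys≈ (here refl)
  ... | here x≡y | _ = x≡y
  ... | there _ | here y≡x = sym y≡x
  ... | there x∈ys | there y∈xs = ⊥-elim (ℤ.<-asym (All.lookup x< y∈xs) (All.lookup y< x∈ys))
  tail : ∀ {a b as bs} → All (a ℤ.<_) as → a ≡ b →
         (∀ {z} → z ∈ a ∷ as → z ∈ b ∷ bs) → ∀ {z} → z ∈ as → z ∈ bs
  tail a< refl ⊆b∷bs z∈as with ⊆b∷bs (there z∈as)
  ... | here refl = ⊥-elim (ℤ.<-irrefl refl (All.lookup a< z∈as))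
  ... | there z∈bs = z∈bs
  xs≈ys : xs ∼[ set ] ys
  xs≈ys = mk⇔ (tail x< x≡y (to xys≈)) (tail y< (sym x≡y) (from xys≈))

canonical-ext : ∀ {C D} → CanonicalClause C → CanonicalClause D → C ∼[ set ] D → C ≡ D
canonical-ext (_ , C<) (_ , D<) =
  sorted-ext (Linked.Linked⇒AllPairs ℤ.<-trans C<) (Linked.Linked⇒AllPairs ℤ.<-trans D<)

canonical-remove : ∀ x {C} → CanonicalClause C → CanonicalClause (remove x C)
canonical-remove x {C} (C-clause , C<) =
  IsClause-⊆ (filter-⊆ _ C) C-clause , Linked.filter⁺ (λ y → ¬? (y ℤ.≟ x)) ℤ.<-trans C<

-- Unsatisfiable hitting clause-sets

SingularLiteral : ClauseSet → Literal → Set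
SingularLiteral F x = ldeg F x ≡ 1 × 0 < ldeg F (- x)

module UnsatHitting {F : ClauseSet} (isF : IsClauseSet F) (unsat : Unsatisfiable F) (hitting : Hitting F) where

  isClause : ∀ {C} → C ∈ F → IsClause C
  isClause C∈F = proj₁ (All.lookup (proj₁ isF) C∈F)

  nonzero : ∀ {C x} → C ∈ F → x ∈ C → x ≢ + 0
  nonzero C∈F = All.lookup (proj₁ (isClause C∈F))

  consistent : ∀ {C x} → C ∈ F → x ∈ C → - x ∉ C
  consistent C∈F = proj₂ (isClause C∈F) _

  -- Otherwise the clause {x} ∪ complement ({s} ∪ B \ {-s}) would meet every clause of F.
  single-occurrence-⊆ : ∀ {A B s x} → A ∈ F → s ∈ A → (∀ {C} → C ∈ F → s ∈ C → C ≡ A) →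
                        B ∈ F → - s ∈ B → x ∈ A → x ≢ s → x ∈ B
  single-occurrence-⊆ {A} {B} {s} {x} A∈F s∈A only-A B∈F -s∈B x∈A x≢s with x ∈? B
  ... | yes x∈B = x∈B
  ... | no x∉B = ⊥-elim (unsat (x ∷ map -_ R , T-clause , All.tabulate T-meets))
    where
    R : Clause
    R = s ∷ remove (- s) B
    -x∉T : - x ∉ map -_ R
    -x∉T -x∈ with ∈-map-neg⁻ -x∈
    ... | here x≡s = x≢s x≡s
    ... | there x∈R = x∉B (proj₁ (∈-remove⁻ B x∈R))
    R-clause : IsClause R
    R-clause = IsClause-∷ (nonzero A∈F s∈A) (λ -s∈ → proj₂ (∈-remove⁻ B -s∈) refl)
                          (IsClause-⊆ (filter-⊆ _ B) (isClause B∈F))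
    T-clause : IsClause (x ∷ map -_ R)
    T-clause = IsClause-∷ (nonzero A∈F x∈A) -x∉T (IsClause-neg R-clause)
    T-meets : ∀ {D} → D ∈ F → ∃ λ z → z ∈ x ∷ map -_ R × z ∈ D
    T-meets {D} D∈F with ≡-dec ℤ._≟_ D B
    ... | yes refl = - s , there (here refl) , -s∈B
    ... | no D≢B with hitting D B D∈F B∈F D≢B
    ...   | z , z∈D , -z∈B with z ℤ.≟ s
    ...     | yes refl = x , here refl , subst (x ∈_) (sym (only-A D∈F z∈D)) x∈A
    ...     | no z≢s = z , there (∈-map-neg⁺ (there (∈-remove⁺ -z∈B (z≢s ∘ neg-injective)))) , z∈D

  -- A clause E ∋ -x contains R \ {x}, so y would occur in both R and E.
  singular-literal-alone : ∀ {x y R} → SingularLiteral F x → ldeg F y ≡ 1 →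
                           R ∈ F → x ∈ R → y ∈ R → x ≡ y
  singular-literal-alone {x} {y} {R} (x-once , -x-occurs) y-once R∈F x∈R y∈R
    with x ℤ.≟ y | count>0⇒∃ (- x ∈?_) {F} -x-occurs
  ... | yes x≡y | _ = x≡y
  ... | no x≢y | E , E∈F , -x∈E =
    contradiction (subst (2 ≤_) y-once (count≥2 (y ∈?_) R∈F E∈F R≢E y∈R y∈E)) λ { (s≤s ()) }
    where
    only-R : ∀ {C} → C ∈ F → x ∈ C → C ≡ R
    only-R C∈F x∈C = let _ , _ , _ , only = count≡1⇒∃! (x ∈?_) x-once
                     in trans (only C∈F x∈C) (sym (only R∈F x∈R))
    y∈E : y ∈ E
    y∈E = single-occurrence-⊆ R∈F x∈R only-R E∈F -x∈E y∈R (x≢y ∘ sym)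
    R≢E : R ≢ E
    R≢E R≡E = consistent E∈F (subst (x ∈_) R≡E x∈R) -x∈E

IsResolvent-neg : ∀ {F v C} → IsResolvent F v C → IsResolvent F (- v) C
IsResolvent-neg {F} {v} {C} (A , B , A∈F , B∈F , v∈A , -v∈B , clash , members) =
  B , A , B∈F , A∈F , -v∈B , subst (_∈ A) (sym (neg-involutive v)) v∈A , clash′ , members′
  where
  clash′ : ∀ x → x ∈ B → - x ∈ A → x ≡ - v
  clash′ x x∈B -x∈A =
    trans (sym (neg-involutive x)) (cong -_ (clash (- x) -x∈A (subst (_∈ B) (sym (neg-involutive x)) x∈B)))
  members′ : ∀ x → x ∈ C ⇔ ((x ∈ B ⊎ x ∈ A) × x ≢ - v × x ≢ - - v)
  members′ x = mk⇔
    (λ x∈C → let x∈A∪B , x≢v , x≢-v = to (members x) x∈C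
             in Sum.swap x∈A∪B , x≢-v , subst (x ≢_) (sym (neg-involutive v)) x≢v)
    (λ (x∈B∪A , x≢-v , x≢v′) →
       from (members x) (Sum.swap x∈B∪A , subst (x ≢_) (neg-involutive v) x≢v′ , x≢-v))

IsDP-neg : ∀ {F v G} → IsDP F v G → IsDP F (- v) G
IsDP-neg {F} {v} {G} (isG , G⇔) = isG , λ C → mk⇔
  (Sum.map IsResolvent-neg
           (λ (C∈F , v∉C , -v∉C) → C∈F , -v∉C , subst (_∉ C) (sym (neg-involutive v)) v∉C)
    ∘ to (G⇔ C))
  (from (G⇔ C) ∘ Sum.map (subst (λ t → IsResolvent F t C) (neg-involutive v) ∘ IsResolvent-neg)
                         (λ (C∈F , -v∉C , v∉C′) → C∈F , subst (_∉ C) (neg-involutive v) v∉C′ , -v∉C))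

⊓≡1 : ∀ {m n} → m ⊓ n ≡ 1 → (m ≡ 1 × 0 < n) ⊎ (n ≡ 1 × 0 < m)
⊓≡1 {1} {suc _} _ = inj₁ (refl , s≤s z≤n)
⊓≡1 {suc (suc _)} {1} _ = inj₂ (refl , s≤s z≤n)
⊓≡1 {zero} ()
⊓≡1 {suc _} {zero} ()
⊓≡1 {suc (suc _)} {suc (suc _)} ()

singular⇒singularLiteral : ∀ {F v} → Singular F v → SingularLiteral F v ⊎ SingularLiteral F (- v)
singular⇒singularLiteral {F} {v} (_ , min≡1) =
  Sum.map₂ (λ (-v-once , v-occurs) → -v-once , subst (λ t → 0 < ldeg F t) (sym (neg-involutive v)) v-occurs)
           (⊓≡1 min≡1)

-- Weights

-- The contribution of a variable with literal degrees a and b to 2 · nosv + nnosv.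
weight : ℕ → ℕ → ℕ
weight 1 1 = 2
weight 1 (suc (suc _)) = 1
weight (suc (suc _)) 1 = 1
weight _ _ = 0

weight-comm : ∀ a b → weight a b ≡ weight b a
weight-comm 0 0 = refl
weight-comm 0 1 = refl
weight-comm 0 (suc (suc _)) = refl
weight-comm 1 0 = refl
weight-comm 1 1 = refl
weight-comm 1 (suc (suc _)) = refl
weight-comm (suc (suc _)) 0 = refl
weight-comm (suc (suc _)) 1 = refl
weight-comm (suc (suc _)) (suc (suc _)) = refl

weight-1-pos : ∀ {b} → 0 < b → 0 < weight 1 b
weight-1-pos {1} _ = s≤s z≤n
weight-1-pos {suc (suc _)} _ = s≤s z≤n

weight-one-singular : ∀ a b → a ⊓ b ≡ 1 → a + b ≡ 2 → weight a b ≡ 2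
weight-one-singular 1 1 _ _ = refl
weight-one-singular 1 (suc (suc _)) _ ()
weight-one-singular (suc (suc a)) 1 _ sum≡2 =
  contradiction (ℕ.suc-injective (ℕ.suc-injective sum≡2)) (ℕ.m+1+n≢0 a)
weight-one-singular zero _ () _
weight-one-singular (suc _) zero () _
weight-one-singular (suc (suc _)) (suc (suc _)) () _

weight-singular : ∀ a b → a ⊓ b ≡ 1 → a + b ≢ 2 → weight a b ≡ 1
weight-singular 1 1 _ sum≢2 = contradiction refl sum≢2
weight-singular 1 (suc (suc _)) _ _ = refl
weight-singular (suc (suc _)) 1 _ _ = refl
weight-singular zero _ () _
weight-singular (suc _) zero () _
weight-singular (suc (suc _)) (suc (suc _)) () _

weight-nonsingular : ∀ a b → a ⊓ b ≢ 1 → weight a b ≡ 0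
weight-nonsingular zero _ _ = refl
weight-nonsingular 1 zero _ = refl
weight-nonsingular 1 (suc _) min≢1 = contradiction refl min≢1
weight-nonsingular (suc (suc _)) zero _ = refl
weight-nonsingular (suc (suc _)) 1 min≢1 = contradiction refl min≢1
weight-nonsingular (suc (suc _)) (suc (suc _)) _ = refl

weight-gain : ∀ a b → weight a b ∸ weight (suc a) b ≡ 0
                    ⊎ (weight a b ∸ weight (suc a) b ≡ 1 × a ≡ 1 × 0 < b)
weight-gain 0 0 = inj₁ refl
weight-gain 0 1 = inj₁ refl
weight-gain 0 (suc (suc _)) = inj₁ refl
weight-gain 1 0 = inj₁ refl
weight-gain 1 1 = inj₂ (refl , refl , s≤s z≤n)
weight-gain 1 (suc (suc _)) = inj₂ (refl , refl , s≤s z≤n)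
weight-gain (suc (suc _)) 0 = inj₁ refl
weight-gain (suc (suc _)) 1 = inj₁ refl
weight-gain (suc (suc _)) (suc (suc _)) = inj₁ refl

litWeight : ClauseSet → Literal → ℕ
litWeight F x = weight (ldeg F x) (ldeg F (- x))

litWeight-neg : ∀ F x → litWeight F (- x) ≡ litWeight F x
litWeight-neg F x = trans (cong (weight (ldeg F (- x)) ∘ ldeg F) (neg-involutive x)) (weight-comm _ _)

litWeight-var : ∀ F x → litWeight F (var x) ≡ litWeight F x
litWeight-var F (+ _) = refl
litWeight-var F ℤ.-[1+ n ] = litWeight-neg F ℤ.-[1+ n ]

potential : ClauseSet → List ℤ → ℕ
potential F L = sum (map (litWeight F) L)

Covers : ClauseSet → List ℤ → Set
Covers F L = ∀ {C x} → C ∈ F → x ∈ C → var x ∈ L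

-- A singular DP-reduction step

module SingularDP {F : ClauseSet} (isF : IsClauseSet F) (unsat : Unsatisfiable F) (hitting : Hitting F)
                  {s : Literal} (s-singular : SingularLiteral F s) {G : ClauseSet} (dp : IsDP F s G) where

  open UnsatHitting isF unsat hitting

  isG : IsClauseSet G
  isG = proj₁ dp

  private
    s-clause : ∃ λ A → A ∈ F × s ∈ A × (∀ {C} → C ∈ F → s ∈ C → C ≡ A)
    s-clause = count≡1⇒∃! (s ∈?_) {F} (proj₁ s-singular)

  A : Clause
  A = proj₁ s-clause

  A∈F : A ∈ F
  A∈F = proj₁ (proj₂ s-clause)

  s∈A : s ∈ A
  s∈A = proj₁ (proj₂ (proj₂ s-clause))

  only-A : ∀ {C} → C ∈ F → s ∈ C → C ≡ A
  only-A = proj₂ (proj₂ (proj₂ s-clause))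

  -s∉A : - s ∉ A
  -s∉A = consistent A∈F s∈A

  ∈A⇒≢-s : ∀ {x} → x ∈ A → x ≢ - s
  ∈A⇒≢-s x∈A refl = -s∉A x∈A

  A⊆ : ∀ {B x} → B ∈ F → - s ∈ B → x ∈ A → x ≢ s → x ∈ B
  A⊆ = single-occurrence-⊆ A∈F s∈A only-A

  rest : ClauseSet
  rest = filter (λ C → ¬? (s ∈? C)) F

  ∈rest⁻ : ∀ {B} → B ∈ rest → B ∈ F × s ∉ B
  ∈rest⁻ = ∈-filter⁻ (λ C → ¬? (s ∈? C)) {xs = F}

  ∈rest⁺ : ∀ {B} → B ∈ F → - s ∈ B → B ∈ rest
  ∈rest⁺ B∈F -s∈B = ∈-filter⁺ (λ C → ¬? (s ∈? C)) B∈F λ s∈B → consistent B∈F s∈B -s∈B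

  ∈rest⇒≢s : ∀ {B z} → B ∈ rest → z ∈ B → z ≢ s
  ∈rest⇒≢s B∈rest z∈B refl = proj₂ (∈rest⁻ B∈rest) z∈B

  -- Since A \ {s} ⊆ B, the resolvent of A and B on s is B \ {-s}.
  ∈-resolvent : ∀ {B} → B ∈ F → - s ∈ B →
                ∀ x → x ∈ remove (- s) B ⇔ ((x ∈ A ⊎ x ∈ B) × x ≢ s × x ≢ - s)
  ∈-resolvent {B} B∈F -s∈B x = mk⇔
    (λ x∈ → let x∈B , x≢-s = ∈-remove⁻ B x∈
            in inj₂ x∈B , (λ { refl → consistent B∈F x∈B -s∈B }) , x≢-s)
    λ { (inj₁ x∈A , x≢s , x≢-s) → ∈-remove⁺ (A⊆ B∈F -s∈B x∈A x≢s) x≢-s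
      ; (inj₂ x∈B , _ , x≢-s) → ∈-remove⁺ x∈B x≢-s }

  resolvent : ∀ {B} → B ∈ F → - s ∈ B → IsResolvent F s (remove (- s) B)
  resolvent {B} B∈F -s∈B = A , B , A∈F , B∈F , s∈A , -s∈B , clash , ∈-resolvent B∈F -s∈B
    where
    clash : ∀ x → x ∈ A → - x ∈ B → x ≡ s
    clash x x∈A -x∈B with x ℤ.≟ s
    ... | yes x≡s = x≡s
    ... | no x≢s = contradiction -x∈B (consistent B∈F (A⊆ B∈F -s∈B x∈A x≢s))

  remove∈G : ∀ {B} → B ∈ rest → remove (- s) B ∈ G
  remove∈G {B} B∈rest with - s ∈? B | ∈rest⁻ B∈rest
  ... | yes -s∈B | B∈F , _ = from (proj₂ dp _) (inj₁ (resolvent B∈F -s∈B))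
  ... | no -s∉B | B∈F , s∉B =
    subst (_∈ G) (sym (remove-∉ -s∉B)) (from (proj₂ dp B) (inj₂ (B∈F , s∉B , -s∉B)))

  G⇒remove : ∀ {C} → C ∈ G → ∃ λ B → B ∈ rest × C ≡ remove (- s) B
  G⇒remove {C} C∈G with to (proj₂ dp C) C∈G
  ... | inj₂ (C∈F , s∉C , -s∉C) = C , ∈-filter⁺ _ C∈F s∉C , sym (remove-∉ -s∉C)
  ... | inj₁ (A′ , B , A′∈F , B∈F , s∈A′ , -s∈B , _ , members) with only-A A′∈F s∈A′
  ...   | refl = B , ∈rest⁺ B∈F -s∈B , canonical-ext (All.lookup (proj₁ isG) C∈G)
                   (canonical-remove (- s) (All.lookup (proj₁ isF) B∈F))
                   λ {x} → mk⇔ (from (∈-resolvent B∈F -s∈B x) ∘ to (members x))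
                               (from (members x) ∘ to (∈-resolvent B∈F -s∈B x))

  G≈ : G ∼[ set ] map (remove (- s)) rest
  G≈ = mk⇔ (λ C∈G → let B , B∈rest , C≡ = G⇒remove C∈G in subst (_∈ _) (sym C≡) (∈-map⁺ _ B∈rest))
           (λ C∈ → let B , B∈rest , C≡ = ∈-map⁻ _ C∈ in subst (_∈ G) (sym C≡) (remove∈G B∈rest))

  clash-in-rest : ∀ {B₁ B₂} → B₁ ∈ rest → B₂ ∈ rest → B₁ ≢ B₂ →
                  ∃ λ z → z ∈ remove (- s) B₁ × - z ∈ remove (- s) B₂
  clash-in-rest B₁∈ B₂∈ B₁≢B₂ with hitting _ _ (proj₁ (∈rest⁻ B₁∈)) (proj₁ (∈rest⁻ B₂∈)) B₁≢B₂
  ... | z , z∈B₁ , -z∈B₂ = z , ∈-remove⁺ z∈B₁ (neg-≢ (∈rest⇒≢s B₂∈ -z∈B₂))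
                             , ∈-remove⁺ -z∈B₂ (∈rest⇒≢s B₁∈ z∈B₁ ∘ neg-injective)

  remove-injective : ∀ {B₁ B₂} → B₁ ∈ rest → B₂ ∈ rest → remove (- s) B₁ ≡ remove (- s) B₂ → B₁ ≡ B₂
  remove-injective {B₁} {B₂} B₁∈ B₂∈ eq with ≡-dec ℤ._≟_ B₁ B₂
  ... | yes B₁≡B₂ = B₁≡B₂
  ... | no B₁≢B₂ with clash-in-rest B₁∈ B₂∈ B₁≢B₂
  ...   | z , z∈ , -z∈ = contradiction (proj₁ (∈-remove⁻ B₂ -z∈))
                           (consistent (proj₁ (∈rest⁻ B₂∈)) (proj₁ (∈-remove⁻ B₂ (subst (z ∈_) eq z∈))))

  unique-remove-rest : Unique (map (remove (- s)) rest)
  unique-remove-rest = unique-map⁺ remove-injective (Unique.filter⁺ (λ C → ¬? (s ∈? C)) (proj₂ isF))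

  -- A clause T satisfying G yields the clause (T \ {-s}) ∪ {s} satisfying F.
  unsat-G : Unsatisfiable G
  unsat-G (T , T-clause , T-meets) = unsat (s ∷ remove (- s) T , T′-clause , All.tabulate meets)
    where
    T′-clause : IsClause (s ∷ remove (- s) T)
    T′-clause = IsClause-∷ (nonzero A∈F s∈A) (λ -s∈ → proj₂ (∈-remove⁻ T -s∈) refl)
                           (IsClause-⊆ (filter-⊆ _ T) T-clause)
    meets : ∀ {D} → D ∈ F → ∃ λ z → z ∈ s ∷ remove (- s) T × z ∈ D
    meets {D} D∈F with s ∈? D
    ... | yes s∈D = s , here refl , s∈D
    ... | no s∉D with All.lookup T-meets (remove∈G (∈-filter⁺ _ D∈F s∉D))
    ...   | z , z∈T , z∈D′ = let z∈D , z≢-s = ∈-remove⁻ D z∈D′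
                             in z , there (∈-remove⁺ z∈T z≢-s) , z∈D

  hitting-G : Hitting G
  hitting-G C D C∈G D∈G C≢D with G⇒remove C∈G | G⇒remove D∈G
  ... | B₁ , B₁∈ , refl | B₂ , B₂∈ , refl = clash-in-rest B₁∈ B₂∈ (C≢D ∘ cong (remove (- s)))

  covers-G : ∀ {L} → Covers F L → Covers G L
  covers-G covers C∈G x∈C with G⇒remove C∈G
  ... | B , B∈rest , refl = covers (proj₁ (∈rest⁻ B∈rest)) (proj₁ (∈-remove⁻ B x∈C))

  unique-A∷rest : Unique (A ∷ rest)
  unique-A∷rest = All.tabulate (λ B∈rest A≡B → proj₂ (∈rest⁻ B∈rest) (subst (s ∈_) A≡B s∈A))
                ∷ Unique.filter⁺ (λ C → ¬? (s ∈? C)) (proj₂ isF)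

  F≈A∷rest : F ∼[ set ] A ∷ rest
  F≈A∷rest {C} = mk⇔ split join
    where
    split : C ∈ F → C ∈ A ∷ rest
    split C∈F with s ∈? C
    ... | yes s∈C = here (only-A C∈F s∈C)
    ... | no s∉C = there (∈-filter⁺ _ C∈F s∉C)
    join : C ∈ A ∷ rest → C ∈ F
    join (here refl) = A∈F
    join (there C∈rest) = proj₁ (∈rest⁻ C∈rest)

  ldeg-F : ∀ x → ldeg F x ≡ count (x ∈?_) (A ∷ rest)
  ldeg-F x = count-∼set (x ∈?_) (proj₂ isF) unique-A∷rest F≈A∷rest

  ldeg-G : ∀ {x} → x ≢ - s → ldeg G x ≡ count (x ∈?_) rest
  ldeg-G {x} x≢-s = begin
    ldeg G x                                  ≡⟨ count-∼set (x ∈?_) (proj₂ isG) unique-remove-rest G≈ ⟩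
    count (x ∈?_) (map (remove (- s)) rest)   ≡⟨ count-map (x ∈?_) (remove (- s)) rest ⟩
    count ((x ∈?_) ∘ remove (- s)) rest       ≡⟨ cong length (filter-≐ _ (x ∈?_) removal-keeps-x rest) ⟩
    count (x ∈?_) rest                        ∎
    where
    open ≡-Reasoning
    removal-keeps-x : (λ B → x ∈ remove (- s) B) ≐ (x ∈_)
    removal-keeps-x = (λ {B} x∈ → proj₁ (∈-remove⁻ B x∈)) , λ x∈B → ∈-remove⁺ x∈B x≢-s

  ldeg-∈A : ∀ {x} → x ∈ A → ldeg F x ≡ suc (ldeg G x)
  ldeg-∈A {x} x∈A = trans (ldeg-F x) (trans (cong length (filter-accept (x ∈?_) x∈A))
                                            (cong suc (sym (ldeg-G (∈A⇒≢-s x∈A)))))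

  ldeg-∉A : ∀ {x} → x ∉ A → x ≢ - s → ldeg F x ≡ ldeg G x
  ldeg-∉A {x} x∉A x≢-s = trans (ldeg-F x) (trans (cong length (filter-reject (x ∈?_) x∉A))
                                                 (sym (ldeg-G x≢-s)))

  ldeg-G-s : ldeg G s ≡ 0
  ldeg-G-s = ℕ.suc-injective (trans (sym (ldeg-∈A s∈A)) (proj₁ s-singular))

  ldeg-F-s̄≤ldeg-G : ∀ {x} → x ∈ A → x ≢ s → ldeg F (- s) ≤ ldeg G x
  ldeg-F-s̄≤ldeg-G {x} x∈A x≢s = begin
    ldeg F (- s)               ≡⟨ ldeg-F (- s) ⟩
    count (- s ∈?_) (A ∷ rest) ≡⟨ cong length (filter-reject (- s ∈?_) -s∉A) ⟩
    count (- s ∈?_) rest       ≤⟨ count-mono (- s ∈?_) (x ∈?_) (λ B∈rest -s∈B →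
                                    A⊆ (proj₁ (∈rest⁻ B∈rest)) -s∈B x∈A x≢s) ⟩
    count (x ∈?_) rest         ≡⟨ ldeg-G (∈A⇒≢-s x∈A) ⟨
    ldeg G x                   ∎
    where open ℕ.≤-Reasoning

  NewlySingular : Literal → Set
  NewlySingular x = x ∈ A × x ≢ s × SingularLiteral G x

  newlySingular⇒ldeg-s̄≡1 : ∀ {x} → NewlySingular x → ldeg F (- s) ≡ 1
  newlySingular⇒ldeg-s̄≡1 (x∈A , x≢s , x-once , _) =
    ℕ.≤-antisym (subst (ldeg F (- s) ≤_) x-once (ldeg-F-s̄≤ldeg-G x∈A x≢s)) (proj₂ s-singular)

  -- All of A \ {s} lies in the clause B \ {-s} of G, for any B ∋ -s.
  newlySingular-unique : ∀ {x y} → NewlySingular x → NewlySingular y → x ≡ y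
  newlySingular-unique (x∈A , x≢s , x-singular) (y∈A , y≢s , y-once , _)
    with count>0⇒∃ (- s ∈?_) {F} (proj₂ s-singular)
  ... | B , B∈F , -s∈B = G.singular-literal-alone x-singular y-once (remove∈G (∈rest⁺ B∈F -s∈B))
                                                  (∈B∖-s x∈A x≢s) (∈B∖-s y∈A y≢s)
    where
    module G = UnsatHitting isG unsat-G hitting-G
    ∈B∖-s : ∀ {z} → z ∈ A → z ≢ s → z ∈ remove (- s) B
    ∈B∖-s z∈A z≢s = ∈-remove⁺ (A⊆ B∈F -s∈B z∈A z≢s) (∈A⇒≢-s z∈A)

  gain : Literal → ℕ
  gain x = litWeight G x ∸ litWeight F x

  gain-neg : ∀ x → gain (- x) ≡ gain x
  gain-neg x = cong₂ _∸_ (litWeight-neg G x) (litWeight-neg F x)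

  litWeight-G-s : litWeight G s ≡ 0
  litWeight-G-s = cong (λ a → weight a (ldeg G (- s))) ldeg-G-s

  gain-s : gain s ≡ 0
  gain-s = trans (cong (_∸ litWeight F s) litWeight-G-s) (ℕ.0∸n≡0 (litWeight F s))

  gain-∈A : ∀ {x} → x ∈ A → x ≢ s → gain x ≡ 0 ⊎ (gain x ≡ 1 × NewlySingular x)
  gain-∈A {x} x∈A x≢s = subst (λ g → g ≡ 0 ⊎ (g ≡ 1 × NewlySingular x)) (sym gain≡)
    (Sum.map₂ (λ (g≡1 , a≡1 , b>0) → g≡1 , x∈A , x≢s , a≡1 , b>0) (weight-gain _ _))
    where
    gain≡ : gain x ≡ weight (ldeg G x) (ldeg G (- x)) ∸ weight (suc (ldeg G x)) (ldeg G (- x))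
    gain≡ = cong₂ (λ a b → litWeight G x ∸ weight a b)
                  (ldeg-∈A x∈A) (ldeg-∉A (consistent A∈F x∈A) (x≢s ∘ neg-injective))

  gain-∉A : ∀ {x} → x ∉ A → - x ∉ A → x ≢ s → x ≢ - s → gain x ≡ 0
  gain-∉A {x} x∉A -x∉A x≢s x≢-s = trans
    (cong₂ (λ a b → litWeight G x ∸ weight a b) (ldeg-∉A x∉A x≢-s) (ldeg-∉A -x∉A (x≢s ∘ neg-injective)))
    (ℕ.n∸n≡0 (litWeight G x))

  gain-cases : ∀ x → gain x ≡ 0 ⊎ (gain x ≡ 1 × ∃ λ y → var y ≡ var x × NewlySingular y)
  gain-cases x with var x ℤ.≟ var s
  ... | yes x~s = inj₁ (begin
    gain x        ≡⟨ gain-var x ⟨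
    gain (var x)  ≡⟨ cong gain x~s ⟩
    gain (var s)  ≡⟨ gain-var s ⟩
    gain s        ≡⟨ gain-s ⟩
    0             ∎)
    where
    open ≡-Reasoning
    gain-var : ∀ y → gain (var y) ≡ gain y
    gain-var y = cong₂ _∸_ (litWeight-var G y) (litWeight-var F y)
  ... | no x≁s with x ∈? A | - x ∈? A
  ...   | yes x∈A | _ = Sum.map₂ (λ (g≡1 , new) → g≡1 , x , refl , new) (gain-∈A x∈A x≢s)
    where x≢s : x ≢ s
          x≢s = x≁s ∘ cong var
  ...   | no _ | yes -x∈A with gain-∈A -x∈A (x≁s ∘ λ -x≡s → trans (sym (var-neg x)) (cong var -x≡s))
  ...     | inj₁ g≡0 = inj₁ (trans (sym (gain-neg x)) g≡0)
  ...     | inj₂ (g≡1 , new) = inj₂ (trans (sym (gain-neg x)) g≡1 , - x , var-neg x , new)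
  gain-cases x | no x≁s | no x∉A | no -x∉A = inj₁ (gain-∉A x∉A -x∉A
    (x≁s ∘ cong var) (x≁s ∘ λ x≡-s → trans (cong var x≡-s) (var-neg s)))

  gain≤1 : ∀ x → gain x ≤ 1
  gain≤1 x = [ (λ g≡0 → ℕ.≤-trans (ℕ.≤-reflexive g≡0) z≤n) , (λ (g≡1 , _) → ℕ.≤-reflexive g≡1) ]′
               (gain-cases x)

  gain>0 : ∀ {x} → 0 < gain x → ∃ λ y → var y ≡ var x × NewlySingular y
  gain>0 {x} pos with gain-cases x
  ... | inj₁ g≡0 = contradiction (subst (0 <_) g≡0 pos) λ ()
  ... | inj₂ (_ , new) = new

  gain-sum<litWeight-s : ∀ {L} → Unique L → All (+ 0 ℤ.<_) L → sum (map gain L) < litWeight F s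
  gain-sum<litWeight-s {L} !L pos with ldeg F (- s) ℕ.≟ 1
  ... | yes s̄-once = subst (sum (map gain L) <_) (sym (cong₂ weight (proj₁ s-singular) s̄-once))
                       (s≤s (sum-map-≤1 gain !L (λ {w} _ → gain≤1 w) at-most-one))
    where
    at-most-one : ∀ {w₁ w₂} → w₁ ∈ L → w₂ ∈ L → 0 < gain w₁ → 0 < gain w₂ → w₁ ≡ w₂
    at-most-one {w₁} {w₂} w₁∈ w₂∈ g₁>0 g₂>0 with gain>0 g₁>0 | gain>0 g₂>0
    ... | y₁ , y₁~w₁ , new₁ | y₂ , y₂~w₂ , new₂ = begin
      w₁      ≡⟨ var-pos (All.lookup pos w₁∈) ⟨
      var w₁  ≡⟨ y₁~w₁ ⟨
      var y₁  ≡⟨ cong var (newlySingular-unique new₁ new₂) ⟩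
      var y₂  ≡⟨ y₂~w₂ ⟩
      var w₂  ≡⟨ var-pos (All.lookup pos w₂∈) ⟩
      w₂      ∎
      where open ≡-Reasoning
  ... | no s̄-not-once = ℕ.<-≤-trans (s≤s (ℕ.≮⇒≥ no-gain)) litWeight-F-s>0
    where
    no-gain : ¬ 0 < sum (map gain L)
    no-gain Σ>0 = let _ , _ , g>0 = sum-map>0⇒∃ gain {L} Σ>0
                      _ , _ , new = gain>0 g>0
                  in s̄-not-once (newlySingular⇒ldeg-s̄≡1 new)
    litWeight-F-s>0 : 0 < litWeight F s
    litWeight-F-s>0 = subst (λ a → 0 < weight a (ldeg F (- s))) (sym (proj₁ s-singular))
                            (weight-1-pos (proj₂ s-singular))

  potential-decreases : ∀ {L} → Unique L → All (+ 0 ℤ.<_) L → var s ∈ L → potential G L < potential F L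
  potential-decreases {L} !L pos s∈L = sum-map-< (litWeight F) (litWeight G) s∈L
    (trans (litWeight-var G s) litWeight-G-s)
    (subst (sum (map gain L) <_) (sym (litWeight-var F s)) (gain-sum<litWeight-s !L pos))

sdp-length≤potential : ∀ {F H n L} → SDPSeq F H n → IsClauseSet F → Unsatisfiable F → Hitting F →
                       Unique L → All (+ 0 ℤ.<_) L → Covers F L → n ≤ potential F L
sdp-length≤potential done _ _ _ _ _ _ = z≤n
sdp-length≤potential {F} {L = L} (step {G = G} {n = n} (v , v-singular , v-dp) seq)
                     isF unsat hitting !L pos covers =
  [ reduce-by v-dp , reduce-by (IsDP-neg v-dp) ]′ (singular⇒singularLiteral {F} v-singular)
  where
  reduce-by : ∀ {s} → IsDP F s G → SingularLiteral F s → suc n ≤ potential F L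
  reduce-by s-dp s-singular = ℕ.≤-trans
    (s≤s (sdp-length≤potential seq isG unsat-G hitting-G !L pos (covers-G covers)))
    (potential-decreases !L pos (covers A∈F s∈A))
    where open SingularDP isF unsat hitting s-singular s-dp

potential≡2*count+count : ∀ F {L} → All (+ 0 ℤ.<_) L →
                          potential F L ≡ 2 * count (OneSingular? F) L + count (NonOneSingular? F) L
potential≡2*count+count F {L} pos =
  sum-map≡2*count+count (OneSingular? F) (NonOneSingular? F) (litWeight F) L
  (λ _ ((_ , min≡1) , sum≡2) → weight-one-singular _ _ min≡1 sum≡2)
  (λ _ (singular , ¬one) → weight-singular _ _ (proj₂ singular) λ sum≡2 → ¬one (singular , sum≡2))
  (λ w∈L ¬one ¬other → weight-nonsingular _ _ λ min≡1 → ¬other ((All.lookup pos w∈L , min≡1) , ¬one))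

vars-positive : ∀ {F} → IsClauseSet F → All (+ 0 ℤ.<_) (vars F)
vars-positive {F} isF = All.tabulate λ w∈ →
  positive (∈-map⁻ var (∈-deduplicate⁻ ℤ._≟_ (map var (concat F)) w∈))
  where
  positive : ∀ {w} → (∃ λ x → x ∈ concat F × w ≡ var x) → + 0 ℤ.< w
  positive (x , x∈ , refl) = let C , x∈C , C∈F = ∈-concat⁻′ F x∈
                             in var>0 (All.lookup (proj₁ (proj₁ (All.lookup (proj₁ isF) C∈F))) x∈C)

vars-covers : ∀ F → Covers F (vars F)
vars-covers F C∈F x∈C = ∈-deduplicate⁺ ℤ._≟_ (∈-map⁺ var (∈-concat⁺′ x∈C C∈F))

corollary7 : (F : ClauseSet) → IsClauseSet F → Unsatisfiable F → Hitting F →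
    (G : ClauseSet) (n : ℕ) → SDPSeq F G n → NoSingular G →
    n ≤ 2 * nosv F + nnosv F
corollary7 F isF unsat hitting G n seq _ = begin
  n                     ≤⟨ sdp-length≤potential seq isF unsat hitting
                             (deduplicate-! _) (vars-positive isF) (vars-covers F) ⟩
  potential F (vars F)  ≡⟨ potential≡2*count+count F (vars-positive isF) ⟩
  2 * nosv F + nnosv F  ∎
  where open ℕ.≤-Reasoning
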